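{- Let $\Pi$ be a projective plane of order $q$ and let $S=\mathcal{P}_S\cup\mathcal{L}_S$ be a resolving set of the incidence graph of $\Pi$ with $|S|\leq 4q-4$, where $\mathcal{P}_S$ is its set of points and $\mathcal{L}_S$ its set of lines. Then $2q-5\leq|\mathcal{P}_S|\leq 2q+1$ and $2q-5\leq|\mathcal{L}_S|\leq 2q+1$.
   Context: The incidence graph of $\Pi$ is the bipartite graph on points and lines with adjacency given by incidence. A set of vertices is resolving if the ordered distance lists of all vertices with respect to it are pairwise distinct. -}

module Defs where

open import Data.Nat using (ℕ; zero; suc; _+_; _<_)
open import Data.Bool using (Bool; true; false; T)
open import Data.Fin using (Fin)
open import Data.Fin.Subset using (Subset; ∣_∣; _∈_)
open import Data.Vec using (tabulate)
open import Data.Sum using (_⊎_; inj₁; inj₂)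
open import Data.Product using (Σ; _×_; _,_)
open import Data.Empty using (⊥)
open import Relation.Nullary using (¬_)
open import Relation.Binary.PropositionalEquality using (_≡_; _≢_)
open import Function.Bundles using (_⇔_)

record ProjectivePlane (q : ℕ) : Set where
  field
    np nl : ℕ
    inc   : Fin np → Fin nl → Bool
    line-through : ∀ (p p' : Fin np) → p ≢ p' →
      Σ (Fin nl) λ l → T (inc p l) × T (inc p' l) ×
        (∀ l' → T (inc p l') → T (inc p' l') → l' ≡ l)
    meet : ∀ (l l' : Fin nl) → l ≢ l' →
      Σ (Fin np) λ p → T (inc p l) × T (inc p l') ×
        (∀ p' → T (inc p' l) → T (inc p' l') → p' ≡ p)
    quadrangle : Σ (Fin np) λ a → Σ (Fin np) λ b → Σ (Fin np) λ c → Σ (Fin np) λ d →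
      a ≢ b × a ≢ c × a ≢ d × b ≢ c × b ≢ d × c ≢ d ×
      (∀ l → ¬ (T (inc a l) × T (inc b l) × T (inc c l))) ×
      (∀ l → ¬ (T (inc a l) × T (inc b l) × T (inc d l))) ×
      (∀ l → ¬ (T (inc a l) × T (inc c l) × T (inc d l))) ×
      (∀ l → ¬ (T (inc b l) × T (inc c l) × T (inc d l)))
    order : ∀ (l : Fin nl) → ∣ tabulate (λ p → inc p l) ∣ ≡ suc q

module _ {q : ℕ} (Π : ProjectivePlane q) where
  open ProjectivePlane Π

  Vertex : Set
  Vertex = Fin np ⊎ Fin nl

  Adj : Vertex → Vertex → Set
  Adj (inj₁ p) (inj₁ p') = ⊥
  Adj (inj₁ p) (inj₂ l)  = T (inc p l)
  Adj (inj₂ l) (inj₁ p)  = T (inc p l)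
  Adj (inj₂ l) (inj₂ l') = ⊥

  data Walk : Vertex → Vertex → ℕ → Set where
    here : ∀ {u} → Walk u u zero
    step : ∀ {u v w k} → Adj u v → Walk v w k → Walk u w (suc k)

  Dist : Vertex → Vertex → ℕ → Set
  Dist u v k = Walk u v k × (∀ j → j < k → ¬ Walk u v j)

  InS : Subset np → Subset nl → Vertex → Set
  InS PS LS (inj₁ p) = p ∈ PS
  InS PS LS (inj₂ l) = l ∈ LS

  Resolving : Subset np → Subset nl → Set
  Resolving PS LS = ∀ (u v : Vertex) →
    (∀ s → InS PS LS s → ∀ k → (Dist u s k ⇔ Dist v s k)) → u ≡ v

-- Write B = P_S and C = L_S. A line outside C is at distance 1 or 3 from a point, according to
-- incidence, and at distance 2 from every other line; so resolvability says that distinct lines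
-- outside C meet B in distinct sets. Hence at most one of them misses B, at most |B| of them are
-- tangent to B (each is determined by its point of contact), and all others meet B at least twice.
-- Counting incidences between B and the lines then gives 2·#lines ≤ |B|(q + 2) + 2|C| + 2, which
-- together with #lines ≥ q² + q + 1 rules out |B| ≤ 2q − 6 when |B| + |C| ≤ 4q − 4. The dual
-- argument bounds |C| from below, and the upper bounds follow from |S| ≤ 4q − 4.
module Submission where

open import Defs
open import Data.Nat using (ℕ; _+_; _*_; _∸_; _≤_)
open import Data.Product using (_×_)
open import Data.Fin.Subset using (Subset; ∣_∣)

open import Data.Nat using (zero; suc; _<_; _≡ᵇ_; z≤n; s≤s; _≤?_)
open import Data.Nat.Properties
open import Data.Nat.Tactic.RingSolver using (solve-∀)
open import Algebra.Properties.Semiring.Sum +-*-semiring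
  using (sum; sum-cong-≗; ∑-comm; ∑-distrib-+; *-distribˡ-sum; *-distribʳ-sum)
open import Data.Bool using (Bool; true; false; T; not; _∧_; if_then_else_)
open import Data.Bool.Properties using (T-∧; not-¬; not-involutive; ∧-idem)
open import Data.Fin using (Fin; zero; suc)
open import Data.Fin.Properties using (any?)
  renaming (_≟_ to _≟ᶠ_; 0≢1+n to fzero≢fsuc; suc-injective to fsuc-injective)
open import Data.Fin.Subset using (_∈_)
open import Data.Vec using ([]; _∷_; lookup; tabulate)
open import Data.Vec.Properties using (lookup∘tabulate; []=⇒lookup)
open import Data.Product using (∃-syntax; _,_; proj₁; proj₂)
open import Data.Sum using (inj₁; inj₂)
open import Data.Sum.Properties using (inj₁-injective; inj₂-injective)
open import Data.Unit using (tt)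
open import Data.Empty using (⊥-elim)
open import Function using (_∘_; flip; case_of_)
open import Function.Bundles using (_⇔_; mk⇔; Equivalence)
open import Function.Construct.Composition using (_⇔-∘_)
open import Function.Construct.Symmetry using (⇔-sym)
open import Relation.Binary.Definitions using (tri<; tri≈; tri>)
open import Relation.Binary.PropositionalEquality
open import Relation.Nullary using (¬_; yes; no)
open import Relation.Nullary.Decidable using (T?)

open Equivalence using (to; from)

𝟙 : Bool → ℕ
𝟙 b = if b then 1 else 0

count : ∀ {n} → (Fin n → Bool) → ℕ
count f = sum (λ i → 𝟙 (f i))

𝟙-T : ∀ {b} → T b → 𝟙 b ≡ 1
𝟙-T {true} _ = refl

𝟙-¬T : ∀ {b} → ¬ T b → 𝟙 b ≡ 0
𝟙-¬T {true} ¬t = ⊥-elim (¬t tt)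
𝟙-¬T {false} _ = refl

T-not : ∀ {b} → T (not b) → ¬ T b
T-not {true} ()

sum-mono-≤ : ∀ {n} {f g : Fin n → ℕ} → (∀ i → f i ≤ g i) → sum f ≤ sum g
sum-mono-≤ {zero} _ = z≤n
sum-mono-≤ {suc n} f≤g = +-mono-≤ (f≤g zero) (sum-mono-≤ (f≤g ∘ suc))

sum-const : ∀ n c → sum {n} (λ _ → c) ≡ n * c
sum-const zero c = refl
sum-const (suc n) c = cong (c +_) (sum-const n c)

term≤sum : ∀ {n} (f : Fin n → ℕ) i → f i ≤ sum f
term≤sum f zero = m≤m+n (f zero) _
term≤sum f (suc i) = ≤-trans (term≤sum (f ∘ suc) i) (m≤n+m _ (f zero))

terms≤sum : ∀ {n} (f : Fin n → ℕ) {i j} → i ≢ j → f i + f j ≤ sum f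
terms≤sum f {zero} {zero} i≢j = ⊥-elim (i≢j refl)
terms≤sum f {zero} {suc j} _ = +-monoʳ-≤ (f zero) (term≤sum (f ∘ suc) j)
terms≤sum f {suc i} {zero} _ =
  subst (_≤ sum f) (+-comm (f zero) (f (suc i))) (+-monoʳ-≤ (f zero) (term≤sum (f ∘ suc) i))
terms≤sum f {suc i} {suc j} i≢j =
  ≤-trans (terms≤sum (f ∘ suc) (i≢j ∘ cong suc)) (m≤n+m _ (f zero))

sum<term+length : ∀ {n} (f : Fin n → ℕ) i → (∀ j → j ≢ i → f j ≤ 1) → sum f < f i + n
sum<term+length {suc n} f zero f≤1 = begin
  suc (f zero + sum (f ∘ suc)) ≡⟨ sym (+-suc (f zero) _) ⟩
  f zero + suc (sum (f ∘ suc)) ≤⟨ +-monoʳ-≤ (f zero) (s≤s rest≤n) ⟩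
  f zero + suc n               ∎
  where
  open ≤-Reasoning
  rest≤n : sum (f ∘ suc) ≤ n
  rest≤n = ≤-trans (sum-mono-≤ (λ j → f≤1 (suc j) (λ ())))
                   (≤-reflexive (trans (sum-const n 1) (*-identityʳ n)))
sum<term+length {suc n} f (suc i) f≤1 = begin
  suc (f zero + sum (f ∘ suc))   ≡⟨ sym (+-suc (f zero) _) ⟩
  f zero + suc (sum (f ∘ suc))   ≤⟨ +-mono-≤ (f≤1 zero (λ ())) rest ⟩
  1 + (f (suc i) + n)            ≡⟨ sym (+-suc (f (suc i)) n) ⟩
  f (suc i) + suc n              ∎
  where
  open ≤-Reasoning
  rest : suc (sum (f ∘ suc)) ≤ f (suc i) + n
  rest = sum<term+length (f ∘ suc) i (λ j j≢i → f≤1 (suc j) (j≢i ∘ fsuc-injective))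

count-pos : ∀ {n} {f : Fin n → Bool} {i} → T (f i) → 1 ≤ count f
count-pos {f = f} {i} t = subst (_≤ count f) (𝟙-T t) (term≤sum (λ j → 𝟙 (f j)) i)

count-none : ∀ {n} {f : Fin n → Bool} → (∀ i → ¬ T (f i)) → count f ≡ 0
count-none {zero} _ = refl
count-none {suc n} none = cong₂ _+_ (𝟙-¬T (none zero)) (count-none (none ∘ suc))

count-witness : ∀ {n} {f : Fin n → Bool} → count f ≢ 0 → ∃[ i ] T (f i)
count-witness {f = f} count≢0 with any? (λ i → T? (f i))
... | yes witness = witness
... | no ¬witness = ⊥-elim (count≢0 (count-none (λ i t → ¬witness (i , t))))

count≤1⇒unique : ∀ {n} {f : Fin n → Bool} {i j} → count f ≤ 1 → T (f i) → T (f j) → i ≡ j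
count≤1⇒unique {f = f} {i} {j} count≤1 ti tj with i ≟ᶠ j
... | yes i≡j = i≡j
... | no i≢j = ⊥-elim (2≰1 (≤-trans two≤count count≤1))
  where
  two≤count : 2 ≤ count f
  two≤count =
    subst (_≤ count f) (cong₂ _+_ (𝟙-T ti) (𝟙-T tj)) (terms≤sum (λ k → 𝟙 (f k)) i≢j)
  2≰1 : ¬ 2 ≤ 1
  2≰1 (s≤s ())

count-≤-𝟙 : ∀ {n} {f : Fin n → Bool} {b} → (∀ {i} → T (f i) → T b) →
  (∀ {i j} → T (f i) → T (f j) → i ≡ j) → count f ≤ 𝟙 b
count-≤-𝟙 {zero} _ _ = z≤n
count-≤-𝟙 {suc n} {f} {b} lands unique with T? (f zero)
... | yes t = ≤-reflexive (begin
  𝟙 (f zero) + count (f ∘ suc) ≡⟨ cong₂ _+_ (𝟙-T t) (count-none {f = f ∘ suc} rest-false) ⟩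
  1                            ≡⟨ 𝟙-T (lands t) ⟨
  𝟙 b                          ∎)
  where
  open ≡-Reasoning
  rest-false : ∀ i → ¬ T (f (suc i))
  rest-false i ti = fzero≢fsuc (unique t ti)
... | no ¬t = subst (_≤ 𝟙 b) (cong (_+ count (f ∘ suc)) (sym (𝟙-¬T ¬t)))
                (count-≤-𝟙 lands (λ ti tj → fsuc-injective (unique ti tj)))

count-∧ˡ : ∀ {n} a (f : Fin n → Bool) → count (λ i → a ∧ f i) ≡ 𝟙 a * count f
count-∧ˡ {n} false f = trans (sum-const n 0) (*-zeroʳ n)
count-∧ˡ true f = sym (+-identityʳ (count f))

-- Double counting the pairs (a, b) related by R.
count-≤-injection : ∀ {m n} {f : Fin m → Bool} {g : Fin n → Bool} (R : Fin m → Fin n → Bool) →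
  (∀ {a} → T (f a) → ∃[ b ] T (R a b)) →
  (∀ {a b} → T (f a) → T (R a b) → T (g b)) →
  (∀ {a a' b} → T (f a) → T (f a') → T (R a b) → T (R a' b) → a ≡ a') →
  count f ≤ count g
count-≤-injection {f = f} {g} R total lands injective = begin
  count f                                 ≤⟨ sum-mono-≤ 𝟙≤partners ⟩
  sum (λ a → count (λ b → f a ∧ R a b))   ≡⟨ ∑-comm (λ a b → 𝟙 (f a ∧ R a b)) ⟩
  sum (λ b → count (λ a → f a ∧ R a b))   ≤⟨ sum-mono-≤ partners≤𝟙 ⟩
  count g                                 ∎
  where
  open ≤-Reasoning
  𝟙≤partners : ∀ a → 𝟙 (f a) ≤ count (λ b → f a ∧ R a b)
  𝟙≤partners a with T? (f a)
  ... | yes t = subst (_≤ count (λ b → f a ∧ R a b)) (sym (𝟙-T t))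
                  (count-pos {f = λ b → f a ∧ R a b} (from T-∧ (t , proj₂ (total t))))
  ... | no ¬t = subst (_≤ count (λ b → f a ∧ R a b)) (sym (𝟙-¬T ¬t)) z≤n
  lands′ : ∀ {a b} → T (f a ∧ R a b) → T (g b)
  lands′ t = let (fa , r) = to T-∧ t in lands fa r
  unique′ : ∀ {a a' b} → T (f a ∧ R a b) → T (f a' ∧ R a' b) → a ≡ a'
  unique′ t t' = let (fa , r) = to T-∧ t ; (fa' , r') = to T-∧ t' in injective fa fa' r r'
  partners≤𝟙 : ∀ b → count (λ a → f a ∧ R a b) ≤ 𝟙 (g b)
  partners≤𝟙 b = count-≤-𝟙 {f = λ a → f a ∧ R a b} lands′ unique′

two≤ : ∀ c t → 2 ≤ t + 2 * 𝟙 c + 2 * 𝟙 (not c ∧ (t ≡ᵇ 0)) + 𝟙 (not c ∧ (t ≡ᵇ 1))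
two≤ true t = ≤-trans (m≤n+m 2 t) (≤-trans (m≤m+n _ 0) (m≤m+n _ 0))
two≤ false zero = ≤-refl
two≤ false (suc zero) = ≤-refl
two≤ false (suc (suc t)) = s≤s (s≤s z≤n)

lower-bound-arith : ∀ {q n P L} → suc (q * suc q) ≤ n → 2 * n ≤ P * suc q + 2 * L + 2 + P →
  P + L ≤ 4 * q ∸ 4 → 2 * q ∸ 5 ≤ P
lower-bound-arith {q} {n} {P} {L} n-large n-small P+L≤ with 2 * q ∸ 5 ≤? P
... | yes P-large = P-large
... | no P-small = ⊥-elim (8≰0 (+-cancelʳ-≤ _ 8 0 (begin
  8 + (2 * n + (P * suc q + 2 * L + 2 + P) + q * (2 * q) + 2 * (4 * q))
    ≡⟨ identity q n P L ⟨
  2 * suc (q * suc q) + 2 * n + q * (suc P + 5) + 2 * (P + L + 4)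
    ≤⟨ +-mono-≤ (+-mono-≤ (+-mono-≤ (*-monoʳ-≤ 2 n-large) n-small) (*-monoʳ-≤ q P+6≤2q))
                (*-monoʳ-≤ 2 P+L+4≤4q) ⟩
  2 * n + (P * suc q + 2 * L + 2 + P) + q * (2 * q) + 2 * (4 * q)
    ∎)))
  where
  open ≤-Reasoning
  -- Adding the four hypotheses with weights 2, 1, q and 2 yields 8 ≤ 0.
  identity : ∀ q n P L → 2 * suc (q * suc q) + 2 * n + q * (suc P + 5) + 2 * (P + L + 4)
    ≡ 8 + (2 * n + (P * suc q + 2 * L + 2 + P) + q * (2 * q) + 2 * (4 * q))
  identity = solve-∀
  8≰0 : ¬ 8 ≤ 0
  8≰0 ()
  1+P≤ : suc P ≤ 2 * q ∸ 5
  1+P≤ = ≰⇒> P-small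
  5≤2q : 5 ≤ 2 * q
  5≤2q = <⇒≤ (m∸n≢0⇒n<m (λ 2q∸5≡0 → case subst (suc P ≤_) 2q∸5≡0 1+P≤ of λ ()))
  P+6≤2q : suc P + 5 ≤ 2 * q
  P+6≤2q = m≤o∸n⇒m+n≤o (suc P) 5≤2q 1+P≤
  P+L+4≤4q : P + L + 4 ≤ 4 * q
  P+L+4≤4q = m≤o∸n⇒m+n≤o (P + L) (≤-trans (≤-trans (n≤1+n 4) 5≤2q) (*-monoˡ-≤ q (m≤m+n 2 2))) P+L≤

upper-bound-arith : ∀ {q P L} → 2 * q ∸ 5 ≤ L → P + L ≤ 4 * q ∸ 4 → P ≤ 2 * q + 1
upper-bound-arith {q} {P} {L} L-large P+L≤ = +-cancelʳ-≤ (2 * q ∸ 5) P (2 * q + 1) (begin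
  P + (2 * q ∸ 5)                    ≤⟨ +-monoʳ-≤ P L-large ⟩
  P + L                              ≤⟨ P+L≤ ⟩
  4 * q ∸ 4                          ≡⟨ cong (_∸ 4) (double q) ⟩
  (2 * q + 2 * q) ∸ 4                ≤⟨ ∸-monoˡ-≤ 4 (+-monoˡ-≤ (2 * q) (m≤n+m∸n (2 * q) 5)) ⟩
  (5 + (2 * q ∸ 5) + 2 * q) ∸ 4      ≡⟨ rearrange (2 * q ∸ 5) (2 * q) ⟩
  2 * q + 1 + (2 * q ∸ 5)            ∎)
  where
  open ≤-Reasoning
  double : ∀ q → 4 * q ≡ 2 * q + 2 * q
  double = solve-∀
  rearrange : ∀ x y → suc (x + y) ≡ y + 1 + x
  rearrange = solve-∀

∣∣≡count : ∀ {n} (P : Subset n) → ∣ P ∣ ≡ count (lookup P)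
∣∣≡count [] = refl
∣∣≡count (true ∷ P) = cong suc (∣∣≡count P)
∣∣≡count (false ∷ P) = ∣∣≡count P

∈⇒T : ∀ {n} {P : Subset n} {i} → i ∈ P → T (lookup P i)
∈⇒T i∈P = subst T (sym ([]=⇒lookup i∈P)) tt

record PartialLinearSpace (q : ℕ) : Set where
  field
    #points #lines : ℕ
    inc : Fin #points → Fin #lines → Bool
    line-unique : ∀ {p p' l l'} → p ≢ p' →
      T (inc p l) → T (inc p' l) → T (inc p l') → T (inc p' l') → l ≡ l'
    line-size : ∀ l → count (λ p → inc p l) ≡ suc q
    point-degree : ∀ p → count (inc p) ≡ suc q

  point-unique : ∀ {l l' p p'} → l ≢ l' →
    T (inc p l) → T (inc p l') → T (inc p' l) → T (inc p' l') → p ≡ p'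
  point-unique {p = p} {p'} l≢l' pl pl' p'l p'l' with p ≟ᶠ p'
  ... | yes p≡p' = p≡p'
  ... | no p≢p' = ⊥-elim (l≢l' (line-unique p≢p' pl p'l pl' p'l'))

dual : ∀ {q} → PartialLinearSpace q → PartialLinearSpace q
dual 𝒮 = record
  { #points = #lines
  ; #lines = #points
  ; inc = flip inc
  ; line-unique = point-unique
  ; line-size = point-degree
  ; point-degree = line-size
  }
  where open PartialLinearSpace 𝒮

module _ {q} (𝒮 : PartialLinearSpace q) where
  open PartialLinearSpace 𝒮

  meets : (Fin #points → Bool) → Fin #lines → ℕ
  meets B l = count (λ p → B p ∧ inc p l)

  ∑-meets : ∀ B → sum (meets B) ≡ count B * suc q
  ∑-meets B = begin
    sum (λ l → count (λ p → B p ∧ inc p l)) ≡⟨ ∑-comm (λ l p → 𝟙 (B p ∧ inc p l)) ⟩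
    sum (λ p → count (λ l → B p ∧ inc p l)) ≡⟨ sum-cong-≗ (λ p → count-∧ˡ (B p) (inc p)) ⟩
    sum (λ p → 𝟙 (B p) * count (inc p))     ≡⟨ sum-cong-≗ (λ p → cong (𝟙 (B p) *_) (point-degree p)) ⟩
    sum (λ p → 𝟙 (B p) * suc q)             ≡⟨ *-distribʳ-sum (suc q) (λ p → 𝟙 (B p)) ⟨
    count B * suc q                         ∎
    where open ≡-Reasoning

  -- (q + 1)² = ∑ₗ |ℓ₀ ∩ l|, where |ℓ₀ ∩ ℓ₀| = q + 1 and every other term is at most 1.
  lines-lower-bound : Fin #lines → suc (q * suc q) ≤ #lines
  lines-lower-bound ℓ₀ = +-cancelˡ-≤ (suc q) _ _ (begin
    suc q + suc (q * suc q)          ≡⟨ +-suc (suc q) (q * suc q) ⟩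
    suc (suc q * suc q)              ≡⟨ cong suc (trans (∑-meets on-ℓ₀) (cong (_* suc q) (line-size ℓ₀))) ⟨
    suc (sum (meets on-ℓ₀))          ≤⟨ sum<term+length (meets on-ℓ₀) ℓ₀ meets≤1 ⟩
    meets on-ℓ₀ ℓ₀ + #lines          ≡⟨ cong (_+ #lines) meets-ℓ₀ ⟩
    suc q + #lines                   ∎)
    where
    open ≤-Reasoning
    on-ℓ₀ : Fin #points → Bool
    on-ℓ₀ p = inc p ℓ₀
    meets-ℓ₀ : meets on-ℓ₀ ℓ₀ ≡ suc q
    meets-ℓ₀ = trans (sum-cong-≗ (λ p → cong 𝟙 (∧-idem (inc p ℓ₀)))) (line-size ℓ₀)
    meets≤1 : ∀ l → l ≢ ℓ₀ → meets on-ℓ₀ l ≤ 1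
    meets≤1 l l≢ℓ₀ = count-≤-𝟙 {b = true} (λ _ → tt) λ t t' →
      let (pℓ₀ , pl) = to T-∧ t ; (p'ℓ₀ , p'l) = to T-∧ t' in
      point-unique (l≢ℓ₀ ∘ sym) pℓ₀ pl p'ℓ₀ p'l

  LinesSeparatedBy : (Fin #points → Bool) → (Fin #lines → Bool) → Set
  LinesSeparatedBy B C = ∀ {l l'} → ¬ T (C l) → ¬ T (C l') →
    (∀ p → T (B p) → T (inc p l) ⇔ T (inc p l')) → l ≡ l'

  module _ {B C} (separated : LinesSeparatedBy B C) where

    skew tangent : Fin #lines → Bool
    skew l = not (C l) ∧ (meets B l ≡ᵇ 0)
    tangent l = not (C l) ∧ (meets B l ≡ᵇ 1)

    count-skew≤1 : count skew ≤ 1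
    count-skew≤1 = count-≤-𝟙 {b = true} (λ _ → tt) λ {l} {l'} t t' →
      let (l∉C , l-skew) = to T-∧ t ; (l'∉C , l'-skew) = to T-∧ t' in
      separated (T-not l∉C) (T-not l'∉C) λ p p∈B →
        mk⇔ (⊥-elim ∘ disjoint l-skew p∈B) (⊥-elim ∘ disjoint l'-skew p∈B)
      where
      disjoint : ∀ {l p} → T (meets B l ≡ᵇ 0) → T (B p) → ¬ T (inc p l)
      disjoint {l} {p} meets≡0 p∈B pl
        with subst (1 ≤_) (≡ᵇ⇒≡ (meets B l) 0 meets≡0)
               (count-pos {f = λ x → B x ∧ inc x l} (from T-∧ (p∈B , pl)))
      ... | ()

    count-tangent≤ : count tangent ≤ count B
    count-tangent≤ =
      count-≤-injection (λ l p → B p ∧ inc p l) contact (λ _ c → proj₁ (to T-∧ c)) same-contact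
      where
      contact : ∀ {l} → T (tangent l) → ∃[ p ] T (B p ∧ inc p l)
      contact {l} t with ≡ᵇ⇒≡ (meets B l) 1 (proj₂ (to T-∧ t))
      ... | meets≡1 = count-witness λ meets≡0 → case trans (sym meets≡1) meets≡0 of λ ()
      on-tangent⇔contact : ∀ {l p x} → T (tangent l) → T (B p ∧ inc p l) → T (B x) → T (inc x l) ⇔ x ≡ p
      on-tangent⇔contact {l} {p} t c x∈B = mk⇔
        (λ xl → count≤1⇒unique {f = λ y → B y ∧ inc y l} meets≤1 (from T-∧ (x∈B , xl)) c)
        (λ { refl → proj₂ (to T-∧ c) })
        where
        meets≤1 : meets B l ≤ 1
        meets≤1 = ≤-reflexive (≡ᵇ⇒≡ (meets B l) 1 (proj₂ (to T-∧ t)))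
      same-contact : ∀ {l l' p} → T (tangent l) → T (tangent l') →
        T (B p ∧ inc p l) → T (B p ∧ inc p l') → l ≡ l'
      same-contact t t' c c' =
        separated (T-not (proj₁ (to T-∧ t))) (T-not (proj₁ (to T-∧ t'))) λ x x∈B →
          ⇔-sym (on-tangent⇔contact t' c' x∈B) ⇔-∘ on-tangent⇔contact t c x∈B

    -- Each line not in C meets B at least twice, or is skew or tangent to B.
    lines-upper-bound : 2 * #lines ≤ count B * suc q + 2 * count C + 2 + count B
    lines-upper-bound = begin
      2 * #lines
        ≡⟨ trans (*-comm 2 #lines) (sym (sum-const #lines 2)) ⟩
      sum {#lines} (λ _ → 2)
        ≤⟨ sum-mono-≤ (λ l → two≤ (C l) (meets B l)) ⟩
      sum (λ l → meets B l + 2 * 𝟙 (C l) + 2 * 𝟙 (skew l) + 𝟙 (tangent l))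
        ≡⟨ sum-linear (meets B) (𝟙 ∘ C) (𝟙 ∘ skew) (𝟙 ∘ tangent) ⟩
      sum (meets B) + 2 * count C + 2 * count skew + count tangent
        ≤⟨ +-mono-≤ (+-mono-≤ (+-monoˡ-≤ (2 * count C) (≤-reflexive (∑-meets B)))
                              (*-monoʳ-≤ 2 count-skew≤1))
                    count-tangent≤ ⟩
      count B * suc q + 2 * count C + 2 + count B
        ∎
      where
      open ≤-Reasoning
      sum-linear : ∀ (f g h k : Fin #lines → ℕ) →
        sum (λ l → f l + 2 * g l + 2 * h l + k l) ≡ sum f + 2 * sum g + 2 * sum h + sum k
      sum-linear f g h k = begin-equality
        sum (λ l → f l + 2 * g l + 2 * h l + k l)
          ≡⟨ ∑-distrib-+ (λ l → f l + 2 * g l + 2 * h l) k ⟩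
        sum (λ l → f l + 2 * g l + 2 * h l) + sum k
          ≡⟨ cong (_+ sum k) (∑-distrib-+ (λ l → f l + 2 * g l) (λ l → 2 * h l)) ⟩
        sum (λ l → f l + 2 * g l) + sum (λ l → 2 * h l) + sum k
          ≡⟨ cong (λ x → x + sum (λ l → 2 * h l) + sum k) (∑-distrib-+ f (λ l → 2 * g l)) ⟩
        sum f + sum (λ l → 2 * g l) + sum (λ l → 2 * h l) + sum k
          ≡⟨ cong₂ (λ x y → sum f + x + y + sum k) (*-distribˡ-sum 2 g) (*-distribˡ-sum 2 h) ⟨
        sum f + 2 * sum g + 2 * sum h + sum k
          ∎

    blocking-lower-bound : Fin #lines → count B + count C ≤ 4 * q ∸ 4 → 2 * q ∸ 5 ≤ count B
    blocking-lower-bound ℓ₀ = lower-bound-arith (lines-lower-bound ℓ₀) lines-upper-bound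

module _ {q} (Π : ProjectivePlane q) where
  open ProjectivePlane Π

  line-unique : ∀ {p p' l l'} → p ≢ p' →
    T (inc p l) → T (inc p' l) → T (inc p l') → T (inc p' l') → l ≡ l'
  line-unique {p} {p'} {l} {l'} p≢p' pl p'l pl' p'l' =
    let (_ , _ , _ , unique) = line-through p p' p≢p' in trans (unique l pl p'l) (sym (unique l' pl' p'l'))

  point-unique : ∀ {l l' p p'} → l ≢ l' →
    T (inc p l) → T (inc p l') → T (inc p' l) → T (inc p' l') → p ≡ p'
  point-unique {l} {l'} {p} {p'} l≢l' pl pl' p'l p'l' =
    let (_ , _ , _ , unique) = meet l l' l≢l' in trans (unique p pl pl') (sym (unique p' p'l p'l'))

  line-size : ∀ l → count (λ p → inc p l) ≡ suc q
  line-size l = begin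
    count (λ p → inc p l)            ≡⟨ sum-cong-≗ (λ p → cong 𝟙 (lookup∘tabulate (λ p → inc p l) p)) ⟨
    count (lookup points-of-l)       ≡⟨ ∣∣≡count points-of-l ⟨
    ∣ points-of-l ∣                  ≡⟨ order l ⟩
    suc q                            ∎
    where
    open ≡-Reasoning
    points-of-l : Subset np
    points-of-l = tabulate (λ p → inc p l)

  point-on : ∀ l → ∃[ p ] T (inc p l)
  point-on l = count-witness λ size≡0 → case trans (sym (line-size l)) size≡0 of λ ()

  -- A point on ab, cd and ac would be a = ab ∩ ac, but a ∉ cd.
  line-avoiding : ∀ p → ∃[ m ] ¬ T (inc p m)
  line-avoiding p with quadrangle
  ... | a , b , c , d , a≢b , a≢c , _ , _ , _ , c≢d , ¬abc , _ , ¬acd , _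
    with line-through a b a≢b | line-through c d c≢d | line-through a c a≢c
  ... | ab , a∈ab , b∈ab , _ | cd , c∈cd , d∈cd , _ | ac , a∈ac , c∈ac , _
    with T? (inc p ab) | T? (inc p cd) | T? (inc p ac)
  ... | no p∉ab | _ | _ = ab , p∉ab
  ... | yes _ | no p∉cd | _ = cd , p∉cd
  ... | yes _ | yes _ | no p∉ac = ac , p∉ac
  ... | yes p∈ab | yes p∈cd | yes p∈ac =
    ⊥-elim (¬acd cd (subst (λ x → T (inc x cd)) p≡a p∈cd , c∈cd , d∈cd))
    where
    ab≢ac : ab ≢ ac
    ab≢ac ab≡ac = ¬abc ac (a∈ac , subst (λ l → T (inc b l)) ab≡ac b∈ab , c∈ac)
    p≡a : p ≡ a
    p≡a = point-unique ab≢ac p∈ab p∈ac a∈ab a∈ac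

  -- The lines through p correspond to the points of a line m avoiding p.
  point-degree : ∀ p → count (inc p) ≡ suc q
  point-degree p with line-avoiding p
  ... | m , p∉m = trans (≤-antisym
        (count-≤-injection (λ l x → inc x l ∧ inc x m) meet-m (λ _ t → proj₂ (to T-∧ t)) same-line)
        (count-≤-injection (λ x l → inc p l ∧ inc x l) join-p (λ _ t → proj₁ (to T-∧ t)) same-point))
      (line-size m)
    where
    meet-m : ∀ {l} → T (inc p l) → ∃[ x ] T (inc x l ∧ inc x m)
    meet-m {l} pl = let (x , xl , xm , _) = meet l m (λ { refl → p∉m pl }) in x , from T-∧ (xl , xm)
    same-line : ∀ {l l' x} → T (inc p l) → T (inc p l') →
      T (inc x l ∧ inc x m) → T (inc x l' ∧ inc x m) → l ≡ l'
    same-line pl pl' t t' =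
      line-unique (λ { refl → p∉m (proj₂ (to T-∧ t)) }) pl (proj₁ (to T-∧ t)) pl' (proj₁ (to T-∧ t'))
    join-p : ∀ {x} → T (inc x m) → ∃[ l ] T (inc p l ∧ inc x l)
    join-p {x} xm = let (l , pl , xl , _) = line-through p x (λ { refl → p∉m xm }) in l , from T-∧ (pl , xl)
    same-point : ∀ {x x' l} → T (inc x m) → T (inc x' m) →
      T (inc p l ∧ inc x l) → T (inc p l ∧ inc x' l) → x ≡ x'
    same-point xm x'm t t' =
      point-unique (λ { refl → p∉m (proj₁ (to T-∧ t)) }) (proj₂ (to T-∧ t)) xm (proj₂ (to T-∧ t')) x'm

  partial-linear-space : PartialLinearSpace q
  partial-linear-space = record
    { #points = np
    ; #lines = nl
    ; inc = inc
    ; line-unique = line-unique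
    ; line-size = line-size
    ; point-degree = point-degree
    }

  side : Vertex Π → Bool
  side (inj₁ _) = false
  side (inj₂ _) = true

  not^ : ℕ → Bool → Bool
  not^ zero b = b
  not^ (suc k) b = not^ k (not b)

  adj-side : ∀ {u v} → Adj Π u v → side v ≡ not (side u)
  adj-side {inj₁ _} {inj₂ _} _ = refl
  adj-side {inj₂ _} {inj₁ _} _ = refl

  walk-side : ∀ {u v k} → Walk Π u v k → side v ≡ not^ k (side u)
  walk-side here = refl
  walk-side {k = suc k} (step a w) = trans (walk-side w) (cong (not^ k) (adj-side a))

  adj-sym : ∀ {u v} → Adj Π u v → Adj Π v u
  adj-sym {inj₁ _} {inj₂ _} a = a
  adj-sym {inj₂ _} {inj₁ _} a = a

  walk-snoc : ∀ {u v w k} → Walk Π u v k → Adj Π v w → Walk Π u w (suc k)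
  walk-snoc here a = step a here
  walk-snoc (step a w) b = step a (walk-snoc w b)

  walk-reverse : ∀ {u v k} → Walk Π u v k → Walk Π v u k
  walk-reverse here = here
  walk-reverse {u} (step {v = x} a w) = walk-snoc (walk-reverse w) (adj-sym {u} {x} a)

  dist-sym : ∀ {u v k} → Dist Π u v k → Dist Π v u k
  dist-sym (w , shortest) = walk-reverse w , λ j j<k w′ → shortest j j<k (walk-reverse w′)

  dist-unique : ∀ {u v d k} → Dist Π u v d → Dist Π u v k → k ≡ d
  dist-unique {d = d} {k} (wd , shortest-d) (wk , shortest-k) with <-cmp k d
  ... | tri< k<d _ _ = ⊥-elim (shortest-d k k<d wk)
  ... | tri≈ _ k≡d _ = k≡d
  ... | tri> _ _ k>d = ⊥-elim (shortest-k d k>d wd)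

  same-dist : ∀ {u v s d} → Dist Π u s d → Dist Π v s d → ∀ k → Dist Π u s k ⇔ Dist Π v s k
  same-dist du dv k = mk⇔ (λ du′ → subst (Dist Π _ _) (sym (dist-unique du du′)) dv)
                          (λ dv′ → subst (Dist Π _ _) (sym (dist-unique dv dv′)) du)

  -- Shorter walks are ruled out by parity, since the incidence graph is bipartite.
  dist₁ : ∀ {u v} → Adj Π u v → Dist Π u v 1
  dist₁ a = step a here , λ { zero _ w → not-¬ (walk-side w) (adj-side a) ; (suc _) (s≤s ()) }

  dist₂ : ∀ {u v w} → u ≢ v → Adj Π u w → Adj Π w v → Dist Π u v 2
  dist₂ {u} {v} u≢v a b = two , shorter
    where
    two : Walk Π u v 2
    two = step a (step b here)
    shorter : ∀ j → j < 2 → ¬ Walk Π u v j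
    shorter zero _ here = u≢v refl
    shorter (suc zero) _ w = not-¬ (walk-side w) (walk-side two)
    shorter (suc (suc _)) (s≤s (s≤s ()))

  dist₃ : ∀ {u v w x} → ¬ Adj Π u v → Adj Π u w → Adj Π w x → Adj Π x v → Dist Π u v 3
  dist₃ {u} {v} ¬uv a b c = three , shorter
    where
    three : Walk Π u v 3
    three = step a (step b (step c here))
    shorter : ∀ j → j < 3 → ¬ Walk Π u v j
    shorter zero _ w = not-¬ (walk-side w) (trans (walk-side three) (not-involutive (not (side u))))
    shorter (suc zero) _ (step uv here) = ¬uv uv
    shorter (suc (suc zero)) _ w = not-¬ (walk-side w) (walk-side three)
    shorter (suc (suc (suc _))) (s≤s (s≤s (s≤s ())))

  line-line-dist : ∀ {l m} → l ≢ m → Dist Π (inj₂ l) (inj₂ m) 2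
  line-line-dist {l} {m} l≢m =
    let (x , xl , xm , _) = meet l m l≢m in dist₂ {w = inj₁ x} (l≢m ∘ inj₂-injective) xl xm

  point-point-dist : ∀ {p x} → p ≢ x → Dist Π (inj₁ p) (inj₁ x) 2
  point-point-dist {p} {x} p≢x =
    let (l , pl , xl , _) = line-through p x p≢x in dist₂ {w = inj₂ l} (p≢x ∘ inj₁-injective) pl xl

  line-point-far : ∀ {p l} → ¬ T (inc p l) → Dist Π (inj₂ l) (inj₁ p) 3
  line-point-far {p} {l} p∉l =
    let (x , xl) = point-on l ; (m , xm , pm , _) = line-through x p (λ { refl → p∉l xl }) in
    dist₃ {w = inj₁ x} {x = inj₂ m} p∉l xl xm pm

  module _ {PS : Subset np} {LS : Subset nl} (resolving : Resolving Π PS LS) where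

    lines-separated : LinesSeparatedBy partial-linear-space (lookup PS) (lookup LS)
    lines-separated {l} {l'} l∉LS l'∉LS same-trace =
      inj₂-injective (resolving (inj₂ l) (inj₂ l') agree)
      where
      agree : ∀ s → InS Π PS LS s → ∀ k → Dist Π (inj₂ l) s k ⇔ Dist Π (inj₂ l') s k
      agree (inj₁ p) p∈PS with T? (inc p l)
      ... | yes pl = same-dist (dist₁ pl) (dist₁ (to (same-trace p (∈⇒T p∈PS)) pl))
      ... | no p∉l =
        same-dist (line-point-far p∉l) (line-point-far (p∉l ∘ from (same-trace p (∈⇒T p∈PS))))
      agree (inj₂ m) m∈LS = same-dist (line-line-dist λ { refl → l∉LS (∈⇒T m∈LS) })
                                      (line-line-dist λ { refl → l'∉LS (∈⇒T m∈LS) })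

    points-separated : LinesSeparatedBy (dual partial-linear-space) (lookup LS) (lookup PS)
    points-separated {p} {p'} p∉PS p'∉PS same-trace =
      inj₁-injective (resolving (inj₁ p) (inj₁ p') agree)
      where
      agree : ∀ s → InS Π PS LS s → ∀ k → Dist Π (inj₁ p) s k ⇔ Dist Π (inj₁ p') s k
      agree (inj₂ l) l∈LS with T? (inc p l)
      ... | yes pl = same-dist (dist₁ pl) (dist₁ (to (same-trace l (∈⇒T l∈LS)) pl))
      ... | no p∉l = same-dist (dist-sym (line-point-far p∉l))
                               (dist-sym (line-point-far (p∉l ∘ from (same-trace l (∈⇒T l∈LS)))))
      agree (inj₁ x) x∈PS = same-dist (point-point-dist λ { refl → p∉PS (∈⇒T x∈PS) })
                                      (point-point-dist λ { refl → p'∉PS (∈⇒T x∈PS) })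

    resolving-lower-bounds : ∣ PS ∣ + ∣ LS ∣ ≤ 4 * q ∸ 4 →
      2 * q ∸ 5 ≤ ∣ PS ∣ × 2 * q ∸ 5 ≤ ∣ LS ∣
    resolving-lower-bounds |S|≤ rewrite ∣∣≡count PS | ∣∣≡count LS =
      blocking-lower-bound partial-linear-space lines-separated some-line |S|≤ ,
      blocking-lower-bound (dual partial-linear-space) points-separated some-point
        (subst (_≤ 4 * q ∸ 4) (+-comm (count (lookup PS)) _) |S|≤)
      where
      some-point : Fin np
      some-point = proj₁ quadrangle
      some-line : Fin nl
      some-line = proj₁ (line-avoiding some-point)

proposition2p4 : ∀ {q : ℕ} (Π : ProjectivePlane q) →
    (PS : Subset (ProjectivePlane.np Π)) → (LS : Subset (ProjectivePlane.nl Π)) →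
    Resolving Π PS LS →
    ∣ PS ∣ + ∣ LS ∣ ≤ 4 * q ∸ 4 →
    (2 * q ∸ 5 ≤ ∣ PS ∣ × ∣ PS ∣ ≤ 2 * q + 1) ×
    (2 * q ∸ 5 ≤ ∣ LS ∣ × ∣ LS ∣ ≤ 2 * q + 1)
proposition2p4 {q} Π PS LS resolving |S|≤ =
  let (PS-large , LS-large) = resolving-lower-bounds Π resolving |S|≤ in
  (PS-large , upper-bound-arith {q} LS-large |S|≤) ,
  (LS-large , upper-bound-arith {q} PS-large (subst (_≤ 4 * q ∸ 4) (+-comm ∣ PS ∣ ∣ LS ∣) |S|≤))
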